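{- Let $k\ge2$. If $C\subseteq[n]$ has cardinality $k+s$ with $s\ge2$, then $C$ is not $k$-bad for $P_n^2$. Equivalently, $q_m(P_n^2,k)=0$ for all $m\ge k+2$.
   Context: The squared path $P_n^2$ is the graph on $[n]=\{1,\dots,n\}$ whose edges are the pairs $\{i,i+1\}$ ($1\le i\le n-1$) and $\{i,i+2\}$ ($1\le i\le n-2$). For a graph $G$ on $[n]$, a subset $C\subseteq[n]$ is called $k$-bad if $|C|\ge k$ and every $k$-element subset of $C$ induces a connected subgraph of $G$. $q_m(G,k)$ denotes the number of $k$-bad subsets $C\subseteq[n]$ with $|C|=m$. -}

module Defs where

open import Data.Nat using (ℕ; _+_; _<_; _≤_; _≥_)
open import Data.Fin using (Fin; toℕ)
open import Data.Fin.Subset using (Subset; _∈_; _⊆_; ∣_∣)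
open import Data.Product using (_×_)
open import Data.Sum using (_⊎_)
open import Relation.Binary.PropositionalEquality using (_≡_)

-- A (simple) graph on the vertex set Fin n (vertex i ↔ i+1 ∈ [n]),
-- given by its adjacency relation.
Graph : ℕ → Set₁
Graph n = Fin n → Fin n → Set

SqPath : (n : ℕ) → Graph n
SqPath n i j =
  (toℕ i < toℕ j × toℕ j ≤ 2 + toℕ i) ⊎ (toℕ j < toℕ i × toℕ i ≤ 2 + toℕ j)

data Walk {n : ℕ} (G : Graph n) (S : Subset n) : Fin n → Fin n → Set where
  here : ∀ {u} → u ∈ S → Walk G S u u
  step : ∀ {u w v} → u ∈ S → G u w → Walk G S w v → Walk G S u v

InducesConnected : {n : ℕ} → Graph n → Subset n → Set
InducesConnected G S = ∀ u v → u ∈ S → v ∈ S → Walk G S u v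

KBad : {n : ℕ} → Graph n → ℕ → Subset n → Set
KBad G k C = (∣ C ∣ ≥ k) × (∀ D → D ⊆ C → ∣ D ∣ ≡ k → InducesConnected G D)

-- Keep the minimum c of C, discard the next s ≥ 2 elements of C and keep the
-- remaining k − 1 ≥ 1.  The resulting k-subset of C has no element in
-- {c + 1, …, c + s}, while edges of P_n^2 join vertices at distance at most 2,
-- so c is an isolated vertex of the subgraph it induces.
module Submission where

open import Defs
open import Data.Nat using (ℕ; zero; suc; _+_; _≤_; _<_; _∸_; z≤n; s≤s)
open import Data.Nat.Properties
  using (≤-trans; <⇒≤; <⇒≱; m≤n⇒m≤1+n; 1+n≰n; +-comm; +-monoʳ-≤; suc-injective; m+n∸n≡m; module ≤-Reasoning)
open import Data.Fin using (Fin; toℕ; zero; suc)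
open import Data.Fin.Subset using (Subset; ∣_∣; _∈_; _⊆_; inside; outside; Nonempty)
open import Data.Vec using ([]; _∷_; here; there)
open import Data.Product using (_,_; proj₁; proj₂)
open import Data.Sum using (_⊎_; inj₁; inj₂)
open import Relation.Binary.PropositionalEquality using (_≡_; refl; sym; trans; cong; subst)
open import Relation.Nullary using (¬_; contradiction)

private
  variable
    n : ℕ

∣p∣>0⇒Nonempty : (p : Subset n) → 0 < ∣ p ∣ → Nonempty p
∣p∣>0⇒Nonempty (inside  ∷ p) _ = zero , here
∣p∣>0⇒Nonempty (outside ∷ p) ∣p∣>0 with x , x∈p ← ∣p∣>0⇒Nonempty p ∣p∣>0 = suc x , there x∈p

dropMin : ℕ → Subset n → Subset n
dropMin zero    p             = p
dropMin (suc j) []            = []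
dropMin (suc j) (inside  ∷ p) = outside ∷ dropMin j p
dropMin (suc j) (outside ∷ p) = outside ∷ dropMin (suc j) p

∣dropMin∣ : ∀ j (p : Subset n) → ∣ dropMin j p ∣ ≡ ∣ p ∣ ∸ j
∣dropMin∣ zero    p             = refl
∣dropMin∣ (suc j) []            = refl
∣dropMin∣ (suc j) (inside  ∷ p) = ∣dropMin∣ j p
∣dropMin∣ (suc j) (outside ∷ p) = ∣dropMin∣ (suc j) p

dropMin⊆ : ∀ j (p : Subset n) → dropMin j p ⊆ p
dropMin⊆ zero    p             x∈ = x∈
dropMin⊆ (suc j) (inside  ∷ p) (there x∈) = there (dropMin⊆ j p x∈)
dropMin⊆ (suc j) (outside ∷ p) (there x∈) = there (dropMin⊆ (suc j) p x∈)

dropMin-≥ : ∀ j (p : Subset n) {x} → x ∈ dropMin j p → j ≤ toℕ x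
dropMin-≥ zero    p             _          = z≤n
dropMin-≥ (suc j) (inside  ∷ p) (there x∈) = s≤s (dropMin-≥ j p x∈)
dropMin-≥ (suc j) (outside ∷ p) (there x∈) = m≤n⇒m≤1+n (dropMin-≥ (suc j) p x∈)

isolateMin : ℕ → Subset n → Subset n
isolateMin j []            = []
isolateMin j (inside  ∷ p) = inside ∷ dropMin j p
isolateMin j (outside ∷ p) = outside ∷ isolateMin j p

isolateMin⊆ : ∀ j (p : Subset n) → isolateMin j p ⊆ p
isolateMin⊆ j (inside  ∷ p) here       = here
isolateMin⊆ j (inside  ∷ p) (there x∈) = there (dropMin⊆ j p x∈)
isolateMin⊆ j (outside ∷ p) (there x∈) = there (isolateMin⊆ j p x∈)

∣isolateMin∣ : ∀ {m} j (p : Subset n) → ∣ p ∣ ≡ suc (m + j) → ∣ isolateMin j p ∣ ≡ suc m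
∣isolateMin∣ {m = m} j (inside ∷ p) ∣p∣≡ =
  cong suc (trans (∣dropMin∣ j p) (trans (cong (_∸ j) (suc-injective ∣p∣≡)) (m+n∸n≡m m j)))
∣isolateMin∣ j (outside ∷ p) ∣p∣≡ = ∣isolateMin∣ j p ∣p∣≡

record Gap (g : ℕ) (D : Subset n) : Set where
  field
    cut            : ℕ
    low high       : Fin n
    low∈D          : low ∈ D
    high∈D         : high ∈ D
    low≤cut        : toℕ low ≤ cut
    cut<high       : cut < toℕ high
    nothingBetween : ∀ {x} → x ∈ D → toℕ x ≤ cut ⊎ cut + g ≤ toℕ x

Gap-outside∷ : ∀ {g} {D : Subset n} → Gap g D → Gap g (outside ∷ D)
Gap-outside∷ G = record
  { cut = suc cut ; low = suc low ; high = suc high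
  ; low∈D = there low∈D ; high∈D = there high∈D
  ; low≤cut = s≤s low≤cut ; cut<high = s≤s cut<high
  ; nothingBetween = λ { (there x∈) → shift (nothingBetween x∈) }
  }
  where
  open Gap G
  shift : ∀ {x} → x ≤ cut ⊎ cut + _ ≤ x → suc x ≤ suc cut ⊎ suc cut + _ ≤ suc x
  shift (inj₁ x≤cut) = inj₁ (s≤s x≤cut)
  shift (inj₂ x≥)    = inj₂ (s≤s x≥)

isolateMin-Gap : ∀ {m} j (p : Subset n) → ∣ p ∣ ≡ suc (suc m + j) → Gap (suc j) (isolateMin j p)
isolateMin-Gap j (outside ∷ p) ∣p∣≡ = Gap-outside∷ (isolateMin-Gap j p ∣p∣≡)
isolateMin-Gap {m = m} j (inside ∷ p) ∣p∣≡ = record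
  { cut = 0 ; low = zero ; high = suc (proj₁ nonempty)
  ; low∈D = here ; high∈D = there (proj₂ nonempty)
  ; low≤cut = z≤n ; cut<high = s≤s z≤n
  ; nothingBetween = λ { here → inj₁ z≤n ; (there y∈) → inj₂ (s≤s (dropMin-≥ j p y∈)) }
  }
  where
  ∣dropMin∣≡ : ∣ dropMin j p ∣ ≡ suc m
  ∣dropMin∣≡ = suc-injective (∣isolateMin∣ j (inside ∷ p) ∣p∣≡)
  nonempty : Nonempty (dropMin j p)
  nonempty = ∣p∣>0⇒Nonempty (dropMin j p) (subst (0 <_) (sym ∣dropMin∣≡) (s≤s z≤n))

source∈ : ∀ {G : Graph n} {S u v} → Walk G S u v → u ∈ S
source∈ (here u∈)     = u∈
source∈ (step u∈ _ _) = u∈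

-- An edge of P_n^2 cannot jump over two consecutive missing vertices.
SqPath-walk-stays-below : ∀ {g cut} {D : Subset n} → 3 ≤ g →
  (∀ {x} → x ∈ D → toℕ x ≤ cut ⊎ cut + g ≤ toℕ x) →
  ∀ {u v} → toℕ u ≤ cut → Walk (SqPath n) D u v → toℕ v ≤ cut
SqPath-walk-stays-below 3≤g split u≤cut (here _) = u≤cut
SqPath-walk-stays-below 3≤g split u≤cut (step _ (inj₂ (w<u , _)) W) =
  SqPath-walk-stays-below 3≤g split (≤-trans (<⇒≤ w<u) u≤cut) W
SqPath-walk-stays-below {g = g} {cut} 3≤g split {u} u≤cut (step _ (inj₁ (_ , w≤2+u)) W)
  with split (source∈ W)
... | inj₁ w≤cut = SqPath-walk-stays-below 3≤g split w≤cut W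
... | inj₂ cut+g≤w = contradiction 3+cut≤2+cut 1+n≰n
  where
  open ≤-Reasoning
  3+cut≤2+cut : 3 + cut ≤ 2 + cut
  3+cut≤2+cut = begin
    3 + cut   ≡⟨ +-comm 3 cut ⟩
    cut + 3   ≤⟨ +-monoʳ-≤ cut 3≤g ⟩
    cut + g   ≤⟨ cut+g≤w ⟩
    _         ≤⟨ w≤2+u ⟩
    2 + toℕ u ≤⟨ +-monoʳ-≤ 2 u≤cut ⟩
    2 + cut   ∎

Gap⇒¬SqPath-connected : ∀ {g} {D : Subset n} → 3 ≤ g → Gap g D → ¬ InducesConnected (SqPath n) D
Gap⇒¬SqPath-connected 3≤g G connected =
  contradiction (SqPath-walk-stays-below 3≤g nothingBetween low≤cut (connected low high low∈D high∈D))
                (<⇒≱ cut<high)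
  where open Gap G

lemma3p5 : (n k s : ℕ) → 2 ≤ k → 2 ≤ s → (C : Subset n) →
    ∣ C ∣ ≡ k + s → ¬ KBad (SqPath n) k C
lemma3p5 n (suc (suc m)) s (s≤s (s≤s z≤n)) 2≤s C ∣C∣≡ (_ , bad) =
  Gap⇒¬SqPath-connected (s≤s 2≤s) (isolateMin-Gap s C ∣C∣≡)
    (bad (isolateMin s C) (isolateMin⊆ s C) (∣isolateMin∣ s C ∣C∣≡))
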